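{- Let $X$ be a connected graph which is not a complete graph. The following are equivalent: (a) $p(X)\ge 2$; (b) $\kappa(X)<\delta(X)$; (c) for every vertex $v$ of $X$, the set of neighbors of $v$ is not a minimum separating set of $X$.
   Context: $\kappa(X)$ (vertex-connectivity) is the minimum number of vertices whose removal leaves a disconnected graph or a single vertex; $\delta(X)$ is the minimum degree. A separating set is a set of vertices whose removal disconnects $X$; a minimum separating set is one of size $\kappa(X)$. If $W$ is a minimum separating set, the connected components of $X-W$ are called parts of $X$. An atomic part is a part with the smallest possible number of vertices, and $p(X)$ denotes the number of vertices of an atomic part. -}

module Defs where

open import Data.Nat using (ℕ; suc; _≤_; _<_)
open import Data.Fin using (Fin)
open import Data.Fin.Subset using (Subset; _∈_; _∉_; ∁; ∣_∣; ⊥)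
open import Data.Bool using (Bool; true; false)
open import Data.Vec using (tabulate)
open import Data.Product using (Σ; ∃; ∃-syntax; _×_; _,_)
open import Data.Sum using (_⊎_)
open import Relation.Nullary using (¬_)
open import Relation.Binary.PropositionalEquality using (_≡_; _≢_)
open import Function.Bundles using (_⇔_)

record Graph (n : ℕ) : Set where
  field
    adj    : Fin n → Fin n → Bool
    sym    : ∀ u v → adj u v ≡ adj v u
    irrefl : ∀ v → adj v v ≡ false

module _ {n : ℕ} (X : Graph n) where
  open Graph X

  data Reach (W : Subset n) (u : Fin n) : Fin n → Set where
    here : u ∉ W → Reach W u u
    step : ∀ {v w} → Reach W u v → adj v w ≡ true → w ∉ W → Reach W u w

  Connected : Set
  Connected = ∀ u v → Reach ⊥ u v

  Complete : Set
  Complete = ∀ u v → u ≢ v → adj u v ≡ true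

  Separating : Subset n → Set
  Separating W = ∃[ u ] ∃[ v ] (u ∉ W × v ∉ W × ¬ Reach W u v)

  Disconnecting : Subset n → Set
  Disconnecting W = Separating W ⊎ ∣ ∁ W ∣ ≡ 1

  IsKappa : ℕ → Set
  IsKappa k = (∃[ W ] (Disconnecting W × ∣ W ∣ ≡ k))
            × (∀ W → Disconnecting W → k ≤ ∣ W ∣)

  N : Fin n → Subset n
  N v = tabulate (adj v)

  deg : Fin n → ℕ
  deg v = ∣ N v ∣

  IsDelta : ℕ → Set
  IsDelta d = (∃[ v ] deg v ≡ d) × (∀ v → d ≤ deg v)

  MinSep : Subset n → Set
  MinSep W = Separating W × IsKappa ∣ W ∣

  -- C is a part of X w.r.t. W: W is a minimum separating set and
  -- C is (the vertex set of) a connected component of X - W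
  IsPart : Subset n → Subset n → Set
  IsPart W C = MinSep W
             × ∃[ u ] (u ∉ W × (∀ v → (v ∈ C) ⇔ (v ∉ W × Reach W u v)))

  -- p(X) ≥ 2 : every part (hence an atomic part) has at least 2 vertices
  p≥2 : Set
  p≥2 = ∀ W C → IsPart W C → 2 ≤ ∣ C ∣

  κ<δ : Set
  κ<δ = ∃[ k ] ∃[ d ] (IsKappa k × IsDelta d × k < d)

  NoNbhdMinSep : Set
  NoNbhdMinSep = ∀ v → ¬ MinSep (N v)

-- In X − N(v) the vertex v is isolated, so N(v) separates X unless v is
-- adjacent to all other vertices. Taking v of minimum degree in a non-complete
-- graph gives κ ≤ δ, with equality exactly when some neighbourhood is a
-- minimum separating set. Such a neighbourhood N(v) makes {v} a part of size
-- one; conversely, if a minimum separating set W has a one-vertex part {u},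
-- then N(u) ⊆ W, and N(u) is itself a minimum separating set.
module Submission where

open import Data.Bool using (Bool; true; false)
open import Data.Bool.Properties using (T-≡) renaming (_≟_ to _≟ᵇ_)
open import Data.Fin using (Fin; zero) renaming (_≟_ to _≟ᶠ_)
open import Data.Fin.Properties using (any?)
open import Data.Fin.Subset using (Subset; _∈_; _∉_; _⊆_; _⊂_; ∁; ∣_∣; ⁅_⁆; _-_)
open import Data.Fin.Subset.Properties
open import Data.Nat using (ℕ; zero; suc; _+_; _∸_; _≤_; _<_; z≤n; s≤s; _≟_; _≤?_)
open import Data.Nat.GeneralisedArithmetic using (fold)
open import Data.Nat.Properties
  using (≤-trans; ≤-antisym; <-≤-trans; <⇒≱; ≤∧≢⇒<; <-irrefl; +-suc; +-identityʳ; module ≤-Reasoning)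
open import Data.Product using (∃; ∃-syntax; _×_; _,_; proj₂)
open import Data.Sum using (_⊎_; inj₁; inj₂)
open import Data.Vec using (tabulate)
open import Data.Vec.Properties using (lookup∘tabulate; []=⇒lookup; lookup⇒[]=)
open import Function.Base using (_∘_)
open import Function.Bundles using (_⇔_; mk⇔; Equivalence)
open import Relation.Nullary using (¬_; Dec; yes; no; contradiction)
open import Relation.Nullary.Decidable using (⌊_⌋; _⊎-dec_; _×-dec_; ¬?; map′; toWitness; fromWitness)
open import Relation.Unary using (Decidable)
open import Relation.Binary.PropositionalEquality using (_≡_; _≢_; refl; sym; trans; cong; subst)

open import Defs

∈-tabulate⁺ : ∀ {n} (f : Fin n → Bool) {x} → f x ≡ true → x ∈ tabulate f
∈-tabulate⁺ f {x} fx = lookup⇒[]= x (tabulate f) (trans (lookup∘tabulate f x) fx)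

∈-tabulate⁻ : ∀ {n} (f : Fin n → Bool) {x} → x ∈ tabulate f → f x ≡ true
∈-tabulate⁻ f {x} x∈ = trans (sym (lookup∘tabulate f x)) ([]=⇒lookup x∈)

module _ {n} {P : Fin n → Set} (P? : Decidable P) where

  subsetOf : Subset n
  subsetOf = tabulate (⌊_⌋ ∘ P?)

  ∈-subsetOf⁺ : ∀ {x} → P x → x ∈ subsetOf
  ∈-subsetOf⁺ {x} px = ∈-tabulate⁺ _ (Equivalence.to T-≡ (fromWitness {a? = P? x} px))

  ∈-subsetOf⁻ : ∀ {x} → x ∈ subsetOf → P x
  ∈-subsetOf⁻ {x} x∈ = toWitness {a? = P? x} (Equivalence.from T-≡ (∈-tabulate⁻ _ x∈))

module _ {n : ℕ} where

  ∁-involutive : (p : Subset n) → ∁ (∁ p) ≡ p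
  ∁-involutive p = ⊆-antisym (λ x∈ → x∉∁p⇒x∈p (x∈∁p⇒x∉p x∈)) (λ x∈ → x∉p⇒x∈∁p (x∈p⇒x∉∁p x∈))

  ∣∁⁅x⁆∣≡n∸1 : (x : Fin n) → ∣ ∁ ⁅ x ⁆ ∣ ≡ n ∸ 1
  ∣∁⁅x⁆∣≡n∸1 x = trans (∣∁p∣≡n∸∣p∣ ⁅ x ⁆) (cong (n ∸_) (∣⁅x⁆∣≡1 x))

  ∣∁∁⁅x⁆∣≡1 : (x : Fin n) → ∣ ∁ (∁ ⁅ x ⁆) ∣ ≡ 1
  ∣∁∁⁅x⁆∣≡1 x = trans (cong ∣_∣ (∁-involutive ⁅ x ⁆)) (∣⁅x⁆∣≡1 x)

  x∉p∧y∉p⇒∣p∣<n∸1 : ∀ {p : Subset n} {x y} → x ∉ p → y ∉ p → x ≢ y → ∣ p ∣ < n ∸ 1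
  x∉p∧y∉p⇒∣p∣<n∸1 {p} {x} {y} x∉p y∉p x≢y = begin-strict
      ∣ p ∣            ≤⟨ p⊆q⇒∣p∣≤∣q∣ p⊆∁⁅x⁆-y ⟩
      ∣ ∁ ⁅ x ⁆ - y ∣  <⟨ x∈p⇒∣p-x∣<∣p∣ (x∉p⇒x∈∁p (x≢y⇒x∉⁅y⁆ (x≢y ∘ sym))) ⟩
      ∣ ∁ ⁅ x ⁆ ∣      ≡⟨ ∣∁⁅x⁆∣≡n∸1 x ⟩
      n ∸ 1            ∎
    where
    open ≤-Reasoning
    p⊆∁⁅x⁆-y : p ⊆ ∁ ⁅ x ⁆ - y
    p⊆∁⁅x⁆-y z∈p = x∈p∧x≢y⇒x∈p-y (x∉p⇒x∈∁p (x≢y⇒x∉⁅y⁆ λ { refl → x∉p z∈p }))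
                                  λ { refl → y∉p z∈p }

  x∈p∧y∈p⇒2≤∣p∣ : ∀ {p : Subset n} {x y} → x ∈ p → y ∈ p → x ≢ y → 2 ≤ ∣ p ∣
  x∈p∧y∈p⇒2≤∣p∣ {p} {x} {y} x∈p y∈p x≢y = begin
      2                ≡⟨ cong suc (sym (∣⁅x⁆∣≡1 y)) ⟩
      suc ∣ ⁅ y ⁆ ∣    ≤⟨ s≤s (p⊆q⇒∣p∣≤∣q∣ ⁅y⁆⊆p-x) ⟩
      suc ∣ p - x ∣    ≤⟨ x∈p⇒∣p-x∣<∣p∣ x∈p ⟩
      ∣ p ∣            ∎
    where
    open ≤-Reasoning
    ⁅y⁆⊆p-x : ⁅ y ⁆ ⊆ p - x
    ⁅y⁆⊆p-x z∈ with refl ← x∈⁅y⁆⇒x≡y y z∈ = x∈p∧x≢y⇒x∈p-y y∈p (x≢y ∘ sym)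

  p⊆q∧p⊄q⇒q⊆p : ∀ {p q : Subset n} → p ⊆ q → ¬ p ⊂ q → q ⊆ p
  p⊆q∧p⊄q⇒q⊆p {p} p⊆q p⊄q {x} x∈q with x ∈? p
  ... | yes x∈p = x∈p
  ... | no  x∉p = contradiction ((λ {y} → p⊆q {y}) , x , x∈q , x∉p) p⊄q

Least : (ℕ → Set) → Set
Least Q = ∃[ k ] (Q k × (∀ i → Q i → k ≤ i))

module _ {Q : ℕ → Set} (Q? : Decidable Q) where

  private
    searchFrom : ∀ j fuel → Q (fuel + j) → (∀ i → Q i → j ≤ i) → Least Q
    searchFrom j fuel q j≤ with Q? j
    ... | yes qj = j , qj , j≤
    searchFrom j zero       q j≤ | no ¬qj = contradiction q ¬qj
    searchFrom j (suc fuel) q j≤ | no ¬qj =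
      searchFrom (suc j) fuel (subst Q (sym (+-suc fuel j)) q)
        (λ i qi → ≤∧≢⇒< (j≤ i qi) λ { refl → ¬qj qi })

  least : ∀ {b} → Q b → Least Q
  least {b} qb = searchFrom 0 b (subst Q (sym (+-identityʳ b)) qb) (λ _ _ → z≤n)

-- The iterates of an inflationary operator grow strictly until they
-- stabilise, and a subset of Fin n cannot grow n + 1 times.
module Stabilisation {n} (f : Subset n → Subset n)
  (inflationary : ∀ R → R ⊆ f R) (monotone : ∀ {R S} → R ⊆ S → f R ⊆ f S)
  (R : Subset n) where

  R⊆fold : ∀ t → R ⊆ fold R f t
  R⊆fold zero    x∈ = x∈
  R⊆fold (suc t) x∈ = inflationary _ (R⊆fold t x∈)

  stable-or-large : ∀ t → f (fold R f t) ⊆ fold R f t ⊎ t ≤ ∣ fold R f t ∣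
  stable-or-large zero = inj₂ z≤n
  stable-or-large (suc t) with stable-or-large t
  ... | inj₁ stable = inj₁ (monotone stable)
  ... | inj₂ t≤ with fold R f t ⊂? f (fold R f t)
  ...   | yes grows = inj₂ (≤-trans (s≤s t≤) (p⊂q⇒∣p∣<∣q∣ grows))
  ...   | no  stuck = inj₁ (monotone (p⊆q∧p⊄q⇒q⊆p (inflationary _) stuck))

  closure : Subset n
  closure = fold R f (suc n)

  closure-stable : f closure ⊆ closure
  closure-stable with stable-or-large (suc n)
  ... | inj₁ stable = stable
  ... | inj₂ large  = contradiction large (<⇒≱ (s≤s (∣p∣≤n closure)))

vertex : ∀ {n} (X : Graph n) → ¬ Complete X → Fin n
vertex {zero}  _ ¬C = contradiction (λ ()) ¬C
vertex {suc _} _ _  = zero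

module _ {n} (X : Graph n) where
  open Graph X using (adj; irrefl)

  ∈N⁺ : ∀ {v w} → adj v w ≡ true → w ∈ N X v
  ∈N⁺ {v} = ∈-tabulate⁺ (adj v)

  ∈N⁻ : ∀ {v w} → w ∈ N X v → adj v w ≡ true
  ∈N⁻ {v} = ∈-tabulate⁻ (adj v)

  v∉N[v] : ∀ {v} → v ∉ N X v
  v∉N[v] {v} v∈ with () ← trans (sym (∈N⁻ v∈)) (irrefl v)

  reach-source : ∀ {W u v} → Reach X W u v → u ∉ W
  reach-source (here u∉W)   = u∉W
  reach-source (step r _ _) = reach-source r

  reach-target : ∀ {W u v} → Reach X W u v → v ∉ W
  reach-target (here v∉W)     = v∉W
  reach-target (step _ _ v∉W) = v∉W

  module _ (W : Subset n) where

    Grown : Subset n → Fin n → Set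
    Grown R w = w ∈ R ⊎ (w ∉ W × ∃[ v ] (v ∈ R × adj v w ≡ true))

    grow : Subset n → Subset n
    grow R = subsetOf {P = Grown R}
      (λ w → w ∈? R ⊎-dec (¬? (w ∈? W) ×-dec any? (λ v → v ∈? R ×-dec adj v w ≟ᵇ true)))

    grow-inflationary : ∀ R → R ⊆ grow R
    grow-inflationary R x∈ = ∈-subsetOf⁺ _ (inj₁ x∈)

    grow-monotone : ∀ {R S} → R ⊆ S → grow R ⊆ grow S
    grow-monotone R⊆S x∈ with ∈-subsetOf⁻ _ x∈
    ... | inj₁ x∈R                = ∈-subsetOf⁺ _ (inj₁ (R⊆S x∈R))
    ... | inj₂ (x∉W , v , v∈R , e) = ∈-subsetOf⁺ _ (inj₂ (x∉W , v , R⊆S v∈R , e))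

    module Reachable (u : Fin n) = Stabilisation grow grow-inflationary grow-monotone ⁅ u ⁆
    open Reachable public using (closure)
    open Reachable using (R⊆fold; closure-stable)

    fold-sound : ∀ {u} → u ∉ W → ∀ t {x} → x ∈ fold ⁅ u ⁆ grow t → Reach X W u x
    fold-sound u∉W zero    x∈ with refl ← x∈⁅y⁆⇒x≡y _ x∈ = here u∉W
    fold-sound u∉W (suc t) x∈ with ∈-subsetOf⁻ _ x∈
    ... | inj₁ x∈R                = fold-sound u∉W t x∈R
    ... | inj₂ (x∉W , v , v∈R , e) = step (fold-sound u∉W t v∈R) e x∉W

    closure-complete : ∀ {u x} → Reach X W u x → x ∈ closure u
    closure-complete {u} (here _)         = R⊆fold u (suc n) (x∈⁅x⁆ u)
    closure-complete {u} (step r e w∉W) =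
      closure-stable u (∈-subsetOf⁺ _ (inj₂ (w∉W , _ , closure-complete r , e)))

  reach? : ∀ W u v → Dec (Reach X W u v)
  reach? W u v with u ∈? W
  ... | yes u∈W = no (λ r → reach-source r u∈W)
  ... | no  u∉W = map′ (fold-sound W u∉W (suc n)) (closure-complete W) (v ∈? closure W u)

  separating? : Decidable (Separating X)
  separating? W = any? λ u → any? λ v →
    ¬? (u ∈? W) ×-dec ¬? (v ∈? W) ×-dec ¬? (reach? W u v)

  κ-exists : Fin n → ∃ (IsKappa X)
  κ-exists x with least {Q = SizeOfDisconnecting} size? (∁ ⁅ x ⁆ , inj₂ (∣∁∁⁅x⁆∣≡1 x) , refl)
    where
    SizeOfDisconnecting : ℕ → Set
    SizeOfDisconnecting k = ∃[ W ] (Disconnecting X W × ∣ W ∣ ≡ k)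
    size? : Decidable SizeOfDisconnecting
    size? k = anySubset? λ W → (separating? W ⊎-dec ∣ ∁ W ∣ ≟ 1) ×-dec ∣ W ∣ ≟ k
  ... | k , disc , k≤ = k , disc , λ W d → k≤ ∣ W ∣ (W , d , refl)

  δ-exists : Fin n → ∃ (IsDelta X)
  δ-exists x with least {Q = λ d → ∃[ v ] deg X v ≡ d} (λ d → any? λ v → deg X v ≟ d) (x , refl)
  ... | d , attained , d≤ = d , attained , λ v → d≤ (deg X v) (v , refl)

  κ-unique : ∀ {k k′} → IsKappa X k → IsKappa X k′ → k ≡ k′
  κ-unique ((W , d , refl) , k≤) ((W′ , d′ , refl) , k′≤) = ≤-antisym (k≤ W′ d′) (k′≤ W d)

  isolated-in-X-N[v] : ∀ {v x} → Reach X (N X v) v x → x ≡ v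
  isolated-in-X-N[v] (here _) = refl
  isolated-in-X-N[v] (step r e w∉N) with refl ← isolated-in-X-N[v] r = contradiction (∈N⁺ e) w∉N

  nonadjacent⇒deg<n∸1 : ∀ {x y} → x ≢ y → adj x y ≡ false → deg X x < n ∸ 1
  nonadjacent⇒deg<n∸1 x≢y ¬xy = x∉p∧y∉p⇒∣p∣<n∸1 v∉N[v] (λ y∈ → true≢false (trans (sym (∈N⁻ y∈)) ¬xy)) x≢y
    where
    true≢false : true ≢ false
    true≢false ()

  full-degree⇒complete : (∀ x → n ∸ 1 ≤ deg X x) → Complete X
  full-degree⇒complete full x y x≢y with adj x y in xy
  ... | true  = refl
  ... | false = contradiction (full x) (<⇒≱ (nonadjacent⇒deg<n∸1 x≢y xy))

  minDegree⇒N-separating : ¬ Complete X → ∀ {v} → (∀ x → deg X v ≤ deg X x) → Separating X (N X v)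
  minDegree⇒N-separating ¬C {v} v-min with any? (λ x → ¬? (x ∈? N X v) ×-dec ¬? (x ≟ᶠ v))
  ... | yes (x , x∉N , x≢v) = v , x , v∉N[v] , x∉N , x≢v ∘ isolated-in-X-N[v]
  ... | no  ∄x = contradiction (full-degree⇒complete λ x → ≤-trans n∸1≤deg[v] (v-min x)) ¬C
    where
    ∁⁅v⁆⊆N : ∁ ⁅ v ⁆ ⊆ N X v
    ∁⁅v⁆⊆N {z} z∈ with z ∈? N X v
    ... | yes z∈N = z∈N
    ... | no  z∉N = contradiction (z , z∉N , x∉⁅y⁆⇒x≢y (x∈∁p⇒x∉p z∈)) ∄x
    n∸1≤deg[v] : n ∸ 1 ≤ deg X v
    n∸1≤deg[v] = subst (_≤ deg X v) (∣∁⁅x⁆∣≡n∸1 v) (p⊆q⇒∣p∣≤∣q∣ ∁⁅v⁆⊆N)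

  singleton-part : ∀ {v} → MinSep X (N X v) → IsPart X (N X v) ⁅ v ⁆
  singleton-part {v} minSep = minSep , v , v∉N[v] , λ x → mk⇔
    (λ x∈ → on-v (x∈⁅y⁆⇒x≡y v x∈))
    (λ (_ , r) → subst (_∈ ⁅ v ⁆) (sym (isolated-in-X-N[v] r)) (x∈⁅x⁆ v))
    where
    on-v : ∀ {x} → x ≡ v → x ∉ N X v × Reach X (N X v) v x
    on-v refl = v∉N[v] , here v∉N[v]

  isolated⇒N-minSep : ∀ {W u} → MinSep X W → u ∉ W → (∀ {x} → Reach X W u x → x ≡ u) →
                      MinSep X (N X u)
  isolated⇒N-minSep {W} {u} ((a , b , a∉W , b∉W , ¬ab) , κW) u∉W only-u =
    N-separating , subst (IsKappa X) (sym ∣N∣≡∣W∣) κW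
    where
    N⊆W : N X u ⊆ W
    N⊆W {w} w∈N with w ∈? W
    ... | yes w∈W = w∈W
    ... | no  w∉W = contradiction (subst (_∈ N X u) (only-u (step (here u∉W) (∈N⁻ w∈N) w∉W)) w∈N) v∉N[v]

    -- W separates a from b, so u cannot reach both of them.
    unreached : ∃[ x ] (x ∉ W × ¬ Reach X W u x)
    unreached with reach? W u a
    ... | no  ¬ua = a , a∉W , ¬ua
    ... | yes ua  = b , b∉W , λ ub → ¬ab (subst (λ z → Reach X W z b) (sym (only-u ua)) ub)

    N-separating : Separating X (N X u)
    N-separating with x , x∉W , ¬ux ← unreached =
      u , x , v∉N[v] , x∉W ∘ N⊆W , λ r → ¬ux (subst (Reach X W u) (sym (isolated-in-X-N[v] r)) (here u∉W))

    ∣N∣≡∣W∣ : ∣ N X u ∣ ≡ ∣ W ∣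
    ∣N∣≡∣W∣ = ≤-antisym (p⊆q⇒∣p∣≤∣q∣ N⊆W) (proj₂ κW _ (inj₁ N-separating))

  p≥2⇒noNbhdMinSep : p≥2 X → NoNbhdMinSep X
  p≥2⇒noNbhdMinSep p≥2 v minSep with s≤s () ← subst (2 ≤_) (∣⁅x⁆∣≡1 v) (p≥2 _ _ (singleton-part minSep))

  noNbhdMinSep⇒p≥2 : NoNbhdMinSep X → p≥2 X
  noNbhdMinSep⇒p≥2 noMinSep W C (minSep , u , u∉W , C⇔component) with 2 ≤? ∣ C ∣
  ... | yes 2≤∣C∣ = 2≤∣C∣
  ... | no  ∣C∣<2 = contradiction (isolated⇒N-minSep minSep u∉W only-u) (noMinSep u)
    where
    in-C : ∀ {x} → Reach X W u x → x ∈ C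
    in-C r = Equivalence.from (C⇔component _) (reach-target r , r)
    only-u : ∀ {x} → Reach X W u x → x ≡ u
    only-u {x} r with x ≟ᶠ u
    ... | yes x≡u = x≡u
    ... | no  x≢u = contradiction (x∈p∧y∈p⇒2≤∣p∣ (in-C r) (in-C (here u∉W)) x≢u) ∣C∣<2

  κ<δ⇒noNbhdMinSep : κ<δ X → NoNbhdMinSep X
  κ<δ⇒noNbhdMinSep (k , d , κ , (_ , d≤) , k<d) v (_ , κ′) =
    <-irrefl (κ-unique κ κ′) (<-≤-trans k<d (d≤ v))

  noNbhdMinSep⇒κ<δ : ¬ Complete X → NoNbhdMinSep X → κ<δ X
  noNbhdMinSep⇒κ<δ ¬C noMinSep with κ-exists (vertex X ¬C) | δ-exists (vertex X ¬C)
  ... | k , κ | _ , δ@((v , refl) , d≤) = k , deg X v , κ , δ , ≤∧≢⇒< k≤δ k≢δ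
    where
    N-separating : Separating X (N X v)
    N-separating = minDegree⇒N-separating ¬C d≤
    k≤δ : k ≤ deg X v
    k≤δ = proj₂ κ (N X v) (inj₁ N-separating)
    k≢δ : k ≢ deg X v
    k≢δ k≡δ = noMinSep v (N-separating , subst (IsKappa X) k≡δ κ)

mainTheorem13 : ∀ {n : ℕ} (X : Graph n) → Connected X → ¬ Complete X →
    (p≥2 X ⇔ κ<δ X) × (κ<δ X ⇔ NoNbhdMinSep X)
mainTheorem13 X _ ¬C =
    mk⇔ (noNbhdMinSep⇒κ<δ X ¬C ∘ p≥2⇒noNbhdMinSep X) (noNbhdMinSep⇒p≥2 X ∘ κ<δ⇒noNbhdMinSep X)
  , mk⇔ (κ<δ⇒noNbhdMinSep X) (noNbhdMinSep⇒κ<δ X ¬C)
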